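{- Let $N\in\mathbb{N}$. For $\beta\neq 0$, \begin{align*} F_{N}(\alpha,\beta;\tau)=(1- \tau q^{N})\sum_{n=0}^{N}\genfrac{[}{]}{0pt}{}{N}{n}\frac{(\alpha q)_n(q)_n\left(\frac{\alpha\tau q}{\beta}\right)_n(\alpha \tau q^2)_{N-1}(\tau\beta)^nq^{n^2}(1-\alpha\tau q^{2n+1})}{(\beta q)_n(\tau)_{n+1}(\alpha \tau q^2)_{N+n}}. \end{align*}
   Context: Here $|q|<1$, $(A)_n=(A;q)_n=(1-A)(1-Aq)\cdots(1-Aq^{n-1})$, $\genfrac{[}{]}{0pt}{}{N}{n}=\frac{(q;q)_N}{(q;q)_n(q;q)_{N-n}}$ is the $q$-binomial coefficient, and $F_{N}(\alpha,\beta;\tau):=\sum_{n=0}^{N}\genfrac{[}{]}{0pt}{}{N}{n}\frac{(\alpha q)_{n}(\tau)_{N-n}(q)_n \tau^{n}}{(\beta q)_{n}(\tau)_N }$. -}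

module Defs where

open import Level using (Level; _⊔_) renaming (suc to lsuc)
open import Algebra.Bundles using (CommutativeRing)
open import Data.Nat using (ℕ; zero; suc; _∸_) renaming (_+_ to _+ℕ_; _*_ to _*ℕ_)
open import Relation.Nullary using (¬_)

-- A field: a commutative ring (with setoid equality ≈) together with a
-- (total) inversion operation which is a genuine multiplicative inverse on
-- every nonzero element, and 1 ≉ 0.  (agda-stdlib 2.3 has no Field bundle.)
-- The value of 0⁻¹ is irrelevant: every division below is guarded by
-- explicit nonvanishing hypotheses in the statement.
record Field (c ℓ : Level) : Set (lsuc (c ⊔ ℓ)) where
  field
    commutativeRing : CommutativeRing c ℓ

  open CommutativeRing commutativeRing public hiding (zero)

  field
    _⁻¹       : Carrier → Carrier
    ⁻¹-cong   : ∀ {x y} → x ≈ y → (x ⁻¹) ≈ (y ⁻¹)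
    ⁻¹-inverse : ∀ x → ¬ (x ≈ 0#) → (x * (x ⁻¹)) ≈ 1#
    1≉0       : ¬ (1# ≈ 0#)

  infixl 7 _/_
  infixl 6 _−_

  _−_ : Carrier → Carrier → Carrier
  x − y = x + (- y)

  _/_ : Carrier → Carrier → Carrier
  x / y = x * (y ⁻¹)

  pow : Carrier → ℕ → Carrier
  pow x zero    = 1#
  pow x (suc n) = pow x n * x

  poch : Carrier → Carrier → ℕ → Carrier
  poch A q zero    = 1#
  poch A q (suc n) = poch A q n * (1# − A * pow q n)

  -- (A;q)_{N-1}, with the standard convention (A;q)_{-1} = 1/(1 - A/q)
  pochPred : Carrier → Carrier → ℕ → Carrier
  pochPred A q zero    = (1# − A / q) ⁻¹
  pochPred A q (suc M) = poch A q M

  qbinom : Carrier → ℕ → ℕ → Carrier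
  qbinom q N n = poch q q N / (poch q q n * poch q q (N ∸ n))

  sumTo : (ℕ → Carrier) → ℕ → Carrier
  sumTo f zero    = f zero
  sumTo f (suc N) = sumTo f N + f (suc N)

  FN : (q α β τ : Carrier) → ℕ → Carrier
  FN q α β τ N = sumTo (λ n →
      (qbinom q N n * poch (α * q) q n * poch τ q (N ∸ n) * poch q q n * pow τ n)
        / (poch (β * q) q n * poch τ q N)) N

  RHS9p2 : (q α β τ : Carrier) → ℕ → Carrier
  RHS9p2 q α β τ N = (1# − τ * pow q N) * sumTo (λ n →
      (qbinom q N n * poch (α * q) q n * poch q q n
         * poch ((α * τ * q) / β) q n * pochPred (α * τ * q * q) q N
         * pow (τ * β) n * pow q (n *ℕ n)
         * (1# − α * τ * pow q (suc (n +ℕ n))))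
        / (poch (β * q) q n * poch τ q (suc n) * poch (α * τ * q * q) q (N +ℕ n))) N

module Submission where

-- F_N = (q)_N/(τ)_N · u N, where u M = Σ_n c n d (M-n) is the
-- convolution of c n = (αq)_n τ^n/(βq)_n and d n = (τ)_n/(q)_n, and the
-- right-hand side is (1-τq^N) (q)_N (ατq²)_{N-1} · w N for a similar sum w.
-- Both u and the rescaled W M = (τ)_{M+1} (ατq²)_M w M satisfy first order
-- recurrences in M, proved by telescoping: the difference of corresponding
-- summands is a difference of explicit certificates, which is a polynomial
-- identity once the first order recurrences of the Pochhammer quotients are
-- used.  The recurrences of (1-ατq^{M+1}) u M and of W M coincide, as do
-- their initial values, so W N = (1-ατq^{N+1}) u N; the theorem follows by
-- cancelling the nonzero factor 1-ατq^{N+1}.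

open import Algebra.Bundles using (CommutativeRing)
open import Data.Nat as ℕ using (ℕ; zero; suc; _≤_; _<_; z≤n; s≤s; _∸_)
  renaming (_+_ to _+ℕ_; _*_ to _*ℕ_)
import Data.Nat.Properties as ℕₚ
open import Data.Integer as ℤ using (ℤ; +_; -[1+_]; _⊖_; _◃_; sign; ∣_∣)
import Data.Integer.Properties as ℤₚ
open import Data.Sign as Sign using (Sign)
open import Data.Maybe using (Maybe; just; nothing)
open import Data.Product using (_×_; proj₁; proj₂)
open import Data.Sum using (inj₁; inj₂)
open import Relation.Nullary using (¬_; yes; no)
open import Relation.Binary.PropositionalEquality as ≡ using (_≡_)
import Algebra.Solver.Ring.AlmostCommutativeRing as ACR
open import Defs

module IntegerCoefficientSolver {k ℓ} (R : CommutativeRing k ℓ) where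
  open CommutativeRing R hiding (zero)
  open import Algebra.Properties.Semiring.Mult.TCOptimised semiring
    using (×1-homo-*; ×-homo-+; 1+×) renaming (_×_ to _·1_)
  open import Algebra.Properties.Ring ring
    using (-‿involutive; -0#≈0#; -‿distribˡ-*; -‿distribʳ-*; -‿+-comm)
  open import Relation.Binary.Reasoning.Setoid setoid

  fromℤ : ℤ → Carrier
  fromℤ (+ n)    = n ·1 1#
  fromℤ -[1+ n ] = - (suc n ·1 1#)

  signed : Sign → Carrier → Carrier
  signed Sign.+ x = x
  signed Sign.- x = - x

  signed-cong : ∀ s {x y} → x ≈ y → signed s x ≈ signed s y
  signed-cong Sign.+ x≈y = x≈y
  signed-cong Sign.- x≈y = -‿cong x≈y

  signed-* : ∀ s t x y → signed (s Sign.* t) (x * y) ≈ signed s x * signed t y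
  signed-* Sign.+ Sign.+ x y = refl
  signed-* Sign.+ Sign.- x y = -‿distribʳ-* x y
  signed-* Sign.- Sign.+ x y = -‿distribˡ-* x y
  signed-* Sign.- Sign.- x y = begin
    x * y           ≈⟨ -‿involutive (x * y) ⟨
    - - (x * y)     ≈⟨ -‿cong (-‿distribʳ-* x y) ⟩
    - (x * - y)     ≈⟨ -‿distribˡ-* x (- y) ⟩
    - x * - y       ∎

  fromℤ-◃ : ∀ s n → fromℤ (s ◃ n) ≈ signed s (n ·1 1#)
  fromℤ-◃ Sign.- zero    = sym -0#≈0#
  fromℤ-◃ Sign.+ zero    = refl
  fromℤ-◃ Sign.- (suc n) = refl
  fromℤ-◃ Sign.+ (suc n) = refl

  fromℤ-sign-abs : ∀ i → fromℤ i ≈ signed (sign i) (∣ i ∣ ·1 1#)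
  fromℤ-sign-abs (+ n)    = refl
  fromℤ-sign-abs -[1+ n ] = refl

  fromℤ-* : ∀ i j → fromℤ (i ℤ.* j) ≈ fromℤ i * fromℤ j
  fromℤ-* i j = begin
    fromℤ ((sign i Sign.* sign j) ◃ (∣ i ∣ ℕ.* ∣ j ∣))
      ≈⟨ fromℤ-◃ (sign i Sign.* sign j) (∣ i ∣ ℕ.* ∣ j ∣) ⟩
    signed (sign i Sign.* sign j) ((∣ i ∣ ℕ.* ∣ j ∣) ·1 1#)
      ≈⟨ signed-cong (sign i Sign.* sign j) (×1-homo-* ∣ i ∣ ∣ j ∣) ⟩
    signed (sign i Sign.* sign j) ((∣ i ∣ ·1 1#) * (∣ j ∣ ·1 1#))
      ≈⟨ signed-* (sign i) (sign j) _ _ ⟩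
    signed (sign i) (∣ i ∣ ·1 1#) * signed (sign j) (∣ j ∣ ·1 1#)
      ≈⟨ *-cong (fromℤ-sign-abs i) (fromℤ-sign-abs j) ⟨
    fromℤ i * fromℤ j ∎

  fromℤ-neg : ∀ i → fromℤ (ℤ.- i) ≈ - fromℤ i
  fromℤ-neg (+ zero)  = sym -0#≈0#
  fromℤ-neg (+ suc n) = refl
  fromℤ-neg -[1+ n ]  = sym (-‿involutive _)

  shift-difference : ∀ x y → x + - y ≈ (1# + x) + - (1# + y)
  shift-difference x y = begin
    x + - y                  ≈⟨ +-identityˡ _ ⟨
    0# + (x + - y)           ≈⟨ +-congʳ (-‿inverseʳ 1#) ⟨
    (1# + - 1#) + (x + - y)  ≈⟨ +-assoc 1# (- 1#) _ ⟩
    1# + (- 1# + (x + - y))  ≈⟨ +-congˡ (+-assoc (- 1#) x (- y)) ⟨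
    1# + ((- 1# + x) + - y)  ≈⟨ +-congˡ (+-congʳ (+-comm (- 1#) x)) ⟩
    1# + ((x + - 1#) + - y)  ≈⟨ +-congˡ (+-assoc x (- 1#) (- y)) ⟩
    1# + (x + (- 1# + - y))  ≈⟨ +-assoc 1# x _ ⟨
    (1# + x) + (- 1# + - y)  ≈⟨ +-congˡ (-‿+-comm 1# y) ⟩
    (1# + x) + - (1# + y)    ∎

  fromℤ-⊖ : ∀ m n → fromℤ (m ⊖ n) ≈ (m ·1 1#) + - (n ·1 1#)
  fromℤ-⊖ m zero = begin
    m ·1 1#           ≈⟨ +-identityʳ _ ⟨
    m ·1 1# + 0#      ≈⟨ +-congˡ -0#≈0# ⟨
    m ·1 1# + - 0#    ∎
  fromℤ-⊖ zero (suc n) = sym (+-identityˡ _)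
  fromℤ-⊖ (suc m) (suc n) = begin
    fromℤ (suc m ⊖ suc n)          ≡⟨ ≡.cong fromℤ (ℤₚ.[1+m]⊖[1+n]≡m⊖n m n) ⟩
    fromℤ (m ⊖ n)                  ≈⟨ fromℤ-⊖ m n ⟩
    m ·1 1# + - (n ·1 1#)          ≈⟨ shift-difference (m ·1 1#) (n ·1 1#) ⟩
    (1# + m ·1 1#) + - (1# + n ·1 1#)
      ≈⟨ +-cong (1+× m 1#) (-‿cong (1+× n 1#)) ⟨
    suc m ·1 1# + - (suc n ·1 1#)  ∎

  fromℤ-+ : ∀ i j → fromℤ (i ℤ.+ j) ≈ fromℤ i + fromℤ j
  fromℤ-+ (+ m)    (+ n)    = ×-homo-+ 1# m n
  fromℤ-+ (+ m)    -[1+ n ] = fromℤ-⊖ m (suc n)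
  fromℤ-+ -[1+ m ] (+ n)    = trans (fromℤ-⊖ n (suc m)) (+-comm _ _)
  fromℤ-+ -[1+ m ] -[1+ n ] = begin
    - (suc (suc (m ℕ.+ n)) ·1 1#)   ≡⟨ ≡.cong (λ k → - (suc k ·1 1#)) (ℕₚ.+-suc m n) ⟨
    - ((suc m ℕ.+ suc n) ·1 1#)     ≈⟨ -‿cong (×-homo-+ 1# (suc m) (suc n)) ⟩
    - (suc m ·1 1# + suc n ·1 1#)   ≈⟨ -‿+-comm _ _ ⟨
    - (suc m ·1 1#) + - (suc n ·1 1#) ∎

  homomorphism : ℤ.+-*-rawRing ACR.-Raw-AlmostCommutative⟶ ACR.fromCommutativeRing R
  homomorphism = record
    { ⟦_⟧ = fromℤ ; +-homo = fromℤ-+ ; *-homo = fromℤ-* ; -‿homo = fromℤ-neg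
    ; 0-homo = refl ; 1-homo = refl }

  coefficient-equality : ∀ i j → Maybe (fromℤ i ≈ fromℤ j)
  coefficient-equality i j with i ℤ.≟ j
  ... | yes ≡.refl = just refl
  ... | no _       = nothing

  open import Algebra.Solver.Ring ℤ.+-*-rawRing (ACR.fromCommutativeRing R)
    homomorphism coefficient-equality public

module FieldFacts {k ℓ} (𝔽 : Field k ℓ) where
  open Field 𝔽
  open IntegerCoefficientSolver commutativeRing public
    using (solve; _:+_; _:*_; _:-_; :-_; con; _:=_)
  open import Relation.Binary.Reasoning.Setoid setoid public
  open import Algebra.Properties.Ring ring public using (-‿involutive)

  Nonzero : Carrier → Set ℓ
  Nonzero x = ¬ (x ≈ 0#)

  *-*⁻¹ : ∀ x {z} → Nonzero z → x * z * z ⁻¹ ≈ x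
  *-*⁻¹ x {z} z≉0 = begin
    x * z * z ⁻¹    ≈⟨ *-assoc x z (z ⁻¹) ⟩
    x * (z * z ⁻¹)  ≈⟨ *-congˡ (⁻¹-inverse z z≉0) ⟩
    x * 1#          ≈⟨ *-identityʳ x ⟩
    x               ∎

  cancelʳ : ∀ {x y z} → Nonzero z → x * z ≈ y * z → x ≈ y
  cancelʳ {x} {y} z≉0 xz≈yz = begin
    x               ≈⟨ *-*⁻¹ x z≉0 ⟨
    x * _ * _ ⁻¹    ≈⟨ *-congʳ xz≈yz ⟩
    y * _ * _ ⁻¹    ≈⟨ *-*⁻¹ y z≉0 ⟩
    y               ∎

  *-nonzero : ∀ {x y} → Nonzero x → Nonzero y → Nonzero (x * y)
  *-nonzero {x} {y} x≉0 y≉0 xy≈0 = x≉0 (cancelʳ y≉0 (trans xy≈0 (sym (zeroˡ y))))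

  nonzero-*ˡ : ∀ {x y} → Nonzero (x * y) → Nonzero x
  nonzero-*ˡ {y = y} xy≉0 x≈0 = xy≉0 (trans (*-congʳ x≈0) (zeroˡ y))

  nonzero-*ʳ : ∀ {x y} → Nonzero (x * y) → Nonzero y
  nonzero-*ʳ {x} xy≉0 y≈0 = xy≉0 (trans (*-congˡ y≈0) (zeroʳ x))

  nonzero-cong : ∀ {x y} → x ≈ y → Nonzero x → Nonzero y
  nonzero-cong x≈y x≉0 y≈0 = x≉0 (trans x≈y y≈0)

  inverse-unique : ∀ {x y} → Nonzero x → x * y ≈ 1# → y ≈ x ⁻¹
  inverse-unique {x} {y} x≉0 xy≈1 = cancelʳ x≉0 (begin
    y * x       ≈⟨ *-comm y x ⟩
    x * y       ≈⟨ xy≈1 ⟩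
    1#          ≈⟨ ⁻¹-inverse x x≉0 ⟨
    x * x ⁻¹    ≈⟨ *-comm x (x ⁻¹) ⟩
    x ⁻¹ * x    ∎)

  ⁻¹-* : ∀ {x y} → Nonzero x → Nonzero y → (x * y) ⁻¹ ≈ x ⁻¹ * y ⁻¹
  ⁻¹-* {x} {y} x≉0 y≉0 = sym (inverse-unique (*-nonzero x≉0 y≉0) (begin
    (x * y) * (x ⁻¹ * y ⁻¹)
      ≈⟨ solve 4 (λ x y x⁻ y⁻ → (x :* y) :* (x⁻ :* y⁻) := (x :* x⁻) :* (y :* y⁻))
           refl x y (x ⁻¹) (y ⁻¹) ⟩
    (x * x ⁻¹) * (y * y ⁻¹)  ≈⟨ *-cong (⁻¹-inverse x x≉0) (⁻¹-inverse y y≉0) ⟩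
    1# * 1#                  ≈⟨ *-identityʳ 1# ⟩
    1#                       ∎))

  +-vanishing : ∀ x w {y y'} → y ≈ y' → x + w * (y − y') ≈ x
  +-vanishing x w {y} {y'} y≈y' = begin
    x + w * (y − y')     ≈⟨ +-congˡ (*-congˡ (+-congʳ y≈y')) ⟩
    x + w * (y' − y')    ≈⟨ solve 3 (λ x w y → x :+ w :* (y :- y) := x) refl x w y' ⟩
    x                    ∎

  1⁻¹ : 1# ⁻¹ ≈ 1#
  1⁻¹ = sym (inverse-unique 1≉0 (*-identityʳ 1#))

  pow-+ : ∀ x m n → pow x (m +ℕ n) ≈ pow x m * pow x n
  pow-+ x zero    n = sym (*-identityˡ _)
  pow-+ x (suc m) n = begin
    pow x (m +ℕ n) * x        ≈⟨ *-congʳ (pow-+ x m n) ⟩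
    pow x m * pow x n * x     ≈⟨ solve 3 (λ a b x → a :* b :* x := a :* x :* b) refl (pow x m) (pow x n) x ⟩
    pow x m * x * pow x n     ∎

  poch-nonzero-≤ : ∀ {A q m n} → m ≤ n → Nonzero (poch A q n) → Nonzero (poch A q m)
  poch-nonzero-≤ {n = zero}  z≤n h = h
  poch-nonzero-≤ {n = suc n} m≤1+n h with ℕₚ.m≤n⇒m<n∨m≡n m≤1+n
  ... | inj₂ ≡.refl      = h
  ... | inj₁ (s≤s m≤n)   = poch-nonzero-≤ m≤n (nonzero-*ˡ h)

  poch-factor-nonzero : ∀ {A q m n} → m < n → Nonzero (poch A q n) →
                        Nonzero (1# − A * pow q m)
  poch-factor-nonzero {A} {q} {m} m<n h = nonzero-*ʳ (poch-nonzero-≤ {A} {q} {suc m} m<n h)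

  poch⁻¹-step : ∀ A q n → Nonzero (poch A q (suc n)) →
                (poch A q n) ⁻¹ ≈ (1# − A * pow q n) * (poch A q (suc n)) ⁻¹
  poch⁻¹-step A q n h = begin
    P ⁻¹                     ≈⟨ *-*⁻¹ (P ⁻¹) h ⟨
    P ⁻¹ * (P * f) * (P * f) ⁻¹
      ≈⟨ *-congʳ (solve 3 (λ P⁻ P f → P⁻ :* (P :* f) := (P :* P⁻) :* f) refl (P ⁻¹) P f) ⟩
    (P * P ⁻¹) * f * (P * f) ⁻¹
      ≈⟨ *-congʳ (*-congʳ (⁻¹-inverse P (nonzero-*ˡ h))) ⟩
    1# * f * (P * f) ⁻¹      ≈⟨ *-congʳ (*-identityˡ f) ⟩
    f * (P * f) ⁻¹           ∎
    where
    P = poch A q n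
    f = 1# − A * pow q n

  ∸-suc-+ : ∀ n j → suc (n +ℕ j) ∸ n ≡ suc j
  ∸-suc-+ n j = ≡.trans (≡.cong (_∸ n) (≡.sym (ℕₚ.+-suc n j))) (ℕₚ.m+n∸m≡n n (suc j))

  qbinom-poch : ∀ q N n → Nonzero (poch q q n) → Nonzero (poch q q (N ∸ n)) →
                qbinom q N n * poch q q n ≈ poch q q N * (poch q q (N ∸ n)) ⁻¹
  qbinom-poch q N n hn hr = begin
    P * (Pn * Pr) ⁻¹ * Pn       ≈⟨ *-congʳ (*-congˡ (⁻¹-* hn hr)) ⟩
    P * (Pn ⁻¹ * Pr ⁻¹) * Pn
      ≈⟨ solve 4 (λ P Pn⁻ Pr⁻ Pn → P :* (Pn⁻ :* Pr⁻) :* Pn := P :* Pr⁻ :* (Pn :* Pn⁻)) refl P (Pn ⁻¹) (Pr ⁻¹) Pn ⟩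
    P * Pr ⁻¹ * (Pn * Pn ⁻¹)    ≈⟨ *-congˡ (⁻¹-inverse Pn hn) ⟩
    P * Pr ⁻¹ * 1#              ≈⟨ *-identityʳ _ ⟩
    P * Pr ⁻¹                   ∎
    where
    P  = poch q q N
    Pn = poch q q n
    Pr = poch q q (N ∸ n)

  pochPred-extend : ∀ B q N → (N ≡ 0 → Nonzero q × Nonzero (1# − B)) →
                    pochPred (B * q) q N * (1# − B * pow q N) ≈ poch (B * q) q N
  pochPred-extend B q zero h = begin
    (1# − B * q / q) ⁻¹ * (1# − B * 1#)   ≈⟨ *-congʳ (⁻¹-cong f≈) ⟩
    (1# − B * 1#) ⁻¹ * (1# − B * 1#)      ≈⟨ *-comm _ _ ⟩
    (1# − B * 1#) * (1# − B * 1#) ⁻¹      ≈⟨ ⁻¹-inverse _ (nonzero-cong (+-congˡ (-‿cong (sym (*-identityʳ B)))) (proj₂ (h ≡.refl))) ⟩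
    1#                                     ∎
    where
    f≈ : 1# − B * q / q ≈ 1# − B * 1#
    f≈ = +-congˡ (-‿cong (trans (*-*⁻¹ B (proj₁ (h ≡.refl))) (sym (*-identityʳ B))))
  pochPred-extend B q (suc M) h = *-congˡ (+-congˡ (-‿cong
    (solve 3 (λ B P q → B :* (P :* q) := B :* q :* P) refl B (pow q M) q)))

  sumTo-cong : ∀ {f g} M → (∀ n → n ≤ M → f n ≈ g n) → sumTo f M ≈ sumTo g M
  sumTo-cong zero    f≈g = f≈g zero z≤n
  sumTo-cong (suc M) f≈g =
    +-cong (sumTo-cong M (λ n n≤M → f≈g n (ℕₚ.m≤n⇒m≤1+n n≤M))) (f≈g (suc M) ℕₚ.≤-refl)

  sumTo-scale : ∀ k f M → k * sumTo f M ≈ sumTo (λ n → k * f n) M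
  sumTo-scale k f zero    = refl
  sumTo-scale k f (suc M) = trans (distribˡ k _ _) (+-congʳ (sumTo-scale k f M))

  telescope : ∀ m (A B H : ℕ → Carrier) →
              (∀ n j → n +ℕ j ≡ m → A n − B n ≈ H (suc n) − H n) →
              A (suc m) ≈ - H (suc m) →
              sumTo A (suc m) ≈ sumTo B m − H 0
  telescope m A B H step last = begin
    sumTo A m + A (suc m)                      ≈⟨ +-cong (partial m ℕₚ.≤-refl) last ⟩
    (sumTo B m + (H (suc m) − H 0)) + - H (suc m)
      ≈⟨ solve 3 (λ s h h₀ → (s :+ (h :- h₀)) :+ (:- h) := s :- h₀) refl (sumTo B m) (H (suc m)) (H 0) ⟩
    sumTo B m − H 0                            ∎
    where
    step′ : ∀ n → n ≤ m → A n − B n ≈ H (suc n) − H n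
    step′ n n≤m = step n _ (proj₂ (ℕₚ.m≤n⇒∃[o]m+o≡n n≤m))

    partial : ∀ n → n ≤ m → sumTo A n ≈ sumTo B n + (H (suc n) − H 0)
    partial zero n≤m = begin
      A 0                       ≈⟨ solve 2 (λ a b → a := b :+ (a :- b)) refl (A 0) (B 0) ⟩
      B 0 + (A 0 − B 0)         ≈⟨ +-congˡ (step′ 0 n≤m) ⟩
      B 0 + (H 1 − H 0)         ∎
    partial (suc n) n<m = begin
      sumTo A n + A (suc n)
        ≈⟨ +-congʳ (partial n (ℕₚ.<⇒≤ n<m)) ⟩
      (sumTo B n + (H (suc n) − H 0)) + A (suc n)
        ≈⟨ solve 5 (λ s b a h h₀ → (s :+ (h :- h₀)) :+ a := (s :+ b) :+ ((a :- b) :+ h :- h₀))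
             refl (sumTo B n) (B (suc n)) (A (suc n)) (H (suc n)) (H 0) ⟩
      (sumTo B n + B (suc n)) + ((A (suc n) − B (suc n)) + H (suc n) − H 0)
        ≈⟨ +-congˡ (+-congʳ (+-congʳ (step′ (suc n) n<m))) ⟩
      (sumTo B n + B (suc n)) + ((H (suc (suc n)) − H (suc n)) + H (suc n) − H 0)
        ≈⟨ +-congˡ (solve 3 (λ h₂ h₁ h₀ → (h₂ :- h₁) :+ h₁ :- h₀ := h₂ :- h₀) refl (H (suc (suc n))) (H (suc n)) (H 0)) ⟩
      (sumTo B n + B (suc n)) + (H (suc (suc n)) − H 0)  ∎

  recurrence-unique : ∀ (a b r x y : ℕ → Carrier) N →
    (∀ m → suc m ≤ N → Nonzero (a m)) →
    (∀ m → suc m ≤ N → a m * x (suc m) ≈ b m * x m + r m) →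
    (∀ m → suc m ≤ N → a m * y (suc m) ≈ b m * y m + r m) →
    x 0 ≈ y 0 → ∀ M → M ≤ N → x M ≈ y M
  recurrence-unique a b r x y N a≉0 rec-x rec-y x₀≈y₀ = go
    where
    go : ∀ M → M ≤ N → x M ≈ y M
    go zero    _   = x₀≈y₀
    go (suc m) m<N = cancelʳ (a≉0 m m<N) (begin
      x (suc m) * a m     ≈⟨ *-comm _ _ ⟩
      a m * x (suc m)     ≈⟨ rec-x m m<N ⟩
      b m * x m + r m     ≈⟨ +-congʳ (*-congˡ (go m (ℕₚ.<⇒≤ m<N))) ⟩
      b m * y m + r m     ≈⟨ rec-y m m<N ⟨
      a m * y (suc m)     ≈⟨ *-comm _ _ ⟩
      y (suc m) * a m     ∎)

module LeftSide {k ℓ} (𝔽 : Field k ℓ) (q α β τ : Field.Carrier 𝔽) where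
  open Field 𝔽
  open FieldFacts 𝔽

  c d u : ℕ → Carrier
  c n = poch (α * q) q n * pow τ n * (poch (β * q) q n) ⁻¹
  d n = poch τ q n * (poch q q n) ⁻¹
  u M = sumTo (λ n → c n * d (M ∸ n)) M

  c-step : ∀ n → Nonzero (poch (β * q) q (suc n)) →
           (1# − β * q * pow q n) * c (suc n) ≈ τ * (1# − α * q * pow q n) * c n
  c-step n h = begin
    fβ * (Pα * fα * (T * τ) * P' ⁻¹)
      ≈⟨ solve 6 (λ fβ Pα fα T τ P⁻ → fβ :* (Pα :* fα :* (T :* τ) :* P⁻) := τ :* fα :* (Pα :* T :* (fβ :* P⁻)))
           refl fβ Pα fα T τ (P' ⁻¹) ⟩
    τ * fα * (Pα * T * (fβ * P' ⁻¹))
      ≈⟨ *-congˡ (*-congˡ (poch⁻¹-step (β * q) q n h)) ⟨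
    τ * fα * (Pα * T * (poch (β * q) q n) ⁻¹)  ∎
    where
    fβ = 1# − β * q * pow q n
    fα = 1# − α * q * pow q n
    Pα = poch (α * q) q n
    T  = pow τ n
    P' = poch (β * q) q (suc n)

  d-step : ∀ j → Nonzero (poch q q (suc j)) →
           (1# − q * pow q j) * d (suc j) ≈ (1# − τ * pow q j) * d j
  d-step j h = begin
    fq * (Pτ * fτ * P' ⁻¹)    ≈⟨ solve 4 (λ fq Pτ fτ P⁻ → fq :* (Pτ :* fτ :* P⁻) := fτ :* (Pτ :* (fq :* P⁻))) refl fq Pτ fτ (P' ⁻¹) ⟩
    fτ * (Pτ * (fq * P' ⁻¹))  ≈⟨ *-congˡ (*-congˡ (poch⁻¹-step q q j h)) ⟨
    fτ * (Pτ * (poch q q j) ⁻¹) ∎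
    where
    fq = 1# − q * pow q j
    fτ = 1# − τ * pow q j
    Pτ = poch τ q j
    P' = poch q q (suc j)

  -- the telescoping certificate of the recurrence for u
  G : ℕ → ℕ → Carrier
  G n j = - (pow q j * (1# − β * pow q n) * (c n * d j))

  term-step : ∀ n j → Nonzero (poch (β * q) q (suc n)) → Nonzero (poch q q (suc j)) →
    (1# − β * pow q (suc (n +ℕ j))) * (c n * d (suc j)) − (1# − α * τ * pow q (suc (n +ℕ j))) * (c n * d j)
      ≈ G (suc n) j − G n (suc j)
  term-step n j hβ hq = begin
    (1# − β * Q) * (c n * d (suc j)) − (1# − α * τ * Q) * (c n * d j)
      ≈⟨ +-cong (*-congʳ (+-congˡ (-‿cong (*-congˡ Q≈XZq)))) (-‿cong (*-congʳ (+-congˡ (-‿cong (*-congˡ Q≈XZq))))) ⟩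
    (1# − β * (X * Z * q)) * (c n * d (suc j)) − (1# − α * τ * (X * Z * q)) * (c n * d j)
      ≈⟨ solve 9 (λ q α β τ X Z c d d' → let 1: = con (+ 1) in
             (1: :- β :* (X :* Z :* q)) :* (c :* d') :- (1: :- α :* τ :* (X :* Z :* q)) :* (c :* d)
             := (:- (Z :* (τ :* (1: :- α :* q :* X) :* c) :* d) :- :- (Z :* q :* (1: :- β :* X) :* (c :* d')))
                :+ c :* ((1: :- q :* Z) :* d' :- (1: :- τ :* Z) :* d))
           refl q α β τ X Z (c n) (d j) (d (suc j)) ⟩
    (- (Z * (τ * (1# − α * q * X) * c n) * d j) − G n (suc j)) + c n * ((1# − q * Z) * d (suc j) − (1# − τ * Z) * d j)
      ≈⟨ +-vanishing _ (c n) (d-step j hq) ⟩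
    - (Z * (τ * (1# − α * q * X) * c n) * d j) − G n (suc j)
      ≈⟨ +-congʳ (-‿cong (*-congʳ (*-congˡ (c-step n hβ)))) ⟨
    - (Z * ((1# − β * q * X) * c (suc n)) * d j) − G n (suc j)
      ≈⟨ +-congʳ (-‿cong (solve 6 (λ Z β q X c' d → let 1: = con (+ 1) in
             Z :* ((1: :- β :* q :* X) :* c') :* d := Z :* (1: :- β :* (X :* q)) :* (c' :* d))
           refl Z β q X (c (suc n)) (d j))) ⟩
    G (suc n) j − G n (suc j) ∎
    where
    X = pow q n
    Z = pow q j
    Q = pow q (suc (n +ℕ j))
    Q≈XZq : Q ≈ X * Z * q
    Q≈XZq = *-congʳ (pow-+ q n j)

  u-step : ∀ m → Nonzero (poch (β * q) q (suc m)) → Nonzero (poch q q (suc m)) →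
    (1# − β * pow q (suc m)) * u (suc m)
      ≈ (1# − α * τ * pow q (suc m)) * u m + (1# − β) * pow q (suc m) * d (suc m)
  u-step m hβ hq = begin
    fβ * u (suc m)                  ≈⟨ sumTo-scale fβ _ (suc m) ⟩
    sumTo A (suc m)                 ≈⟨ telescope m A B H step last ⟩
    sumTo B m − H 0                 ≈⟨ +-cong (sumTo-scale fατ _ m) (-‿cong (sym first)) ⟨
    fατ * u m − - ((1# − β) * pow q (suc m) * d (suc m))
      ≈⟨ +-congˡ (-‿involutive _) ⟩
    fατ * u m + (1# − β) * pow q (suc m) * d (suc m) ∎
    where
    fβ  = 1# − β * pow q (suc m)
    fατ = 1# − α * τ * pow q (suc m)
    A B H : ℕ → Carrier
    A n = fβ * (c n * d (suc m ∸ n))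
    B n = fατ * (c n * d (m ∸ n))
    H n = G n (suc m ∸ n)
    step : ∀ n j → n +ℕ j ≡ m → A n − B n ≈ H (suc n) − H n
    step n j ≡.refl rewrite ∸-suc-+ n j | ℕₚ.m+n∸m≡n n j =
      term-step n j (poch-nonzero-≤ (s≤s (ℕₚ.m≤m+n n j)) hβ) (poch-nonzero-≤ (s≤s (ℕₚ.m≤n+m j n)) hq)
    last : A (suc m) ≈ - H (suc m)
    last rewrite ℕₚ.n∸n≡0 m = solve 2 (λ f x → f :* x := :- (:- (con (+ 1) :* f :* x))) refl fβ (c (suc m) * d 0)
    first : H 0 ≈ - ((1# − β) * pow q (suc m) * d (suc m))
    first = -‿cong (begin
      pow q (suc m) * (1# − β * 1#) * (1# * 1# * 1# ⁻¹ * d (suc m))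
        ≈⟨ *-congˡ (*-congʳ (*-congˡ 1⁻¹)) ⟩
      pow q (suc m) * (1# − β * 1#) * (1# * 1# * 1# * d (suc m))
        ≈⟨ solve 3 (λ Q β d → let 1: = con (+ 1) in
               Q :* (1: :- β :* 1:) :* (1: :* 1: :* 1: :* d) := (1: :- β) :* Q :* d) refl (pow q (suc m)) β (d (suc m)) ⟩
      (1# − β) * pow q (suc m) * d (suc m) ∎)

  u₀ : u 0 ≈ 1#
  u₀ = begin
    1# * 1# * 1# ⁻¹ * (1# * 1# ⁻¹)   ≈⟨ *-cong (*-congˡ 1⁻¹) (*-congˡ 1⁻¹) ⟩
    1# * 1# * 1# * (1# * 1#)         ≈⟨ solve 0 (let 1: = con (+ 1) in 1: :* 1: :* 1: :* (1: :* 1:) := 1:) refl ⟩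
    1#                               ∎

  F-as-convolution : ∀ N → Nonzero (poch q q N) → Nonzero (poch (β * q) q N) → Nonzero (poch τ q N) →
                     FN q α β τ N ≈ poch q q N * (poch τ q N) ⁻¹ * u N
  F-as-convolution N hq hβ hτ = begin
    FN q α β τ N                                       ≈⟨ sumTo-cong N term ⟩
    sumTo (λ n → Q * T ⁻¹ * (c n * d (N ∸ n))) N       ≈⟨ sumTo-scale _ _ N ⟨
    Q * T ⁻¹ * u N                                     ∎
    where
    Q = poch q q N
    T = poch τ q N
    term : ∀ n → n ≤ N →
      (qbinom q N n * poch (α * q) q n * poch τ q (N ∸ n) * poch q q n * pow τ n) / (poch (β * q) q n * T)
        ≈ Q * T ⁻¹ * (c n * d (N ∸ n))
    term n n≤N = begin
      (b * Pα * Tr * Qn * t) * (Pβ * T) ⁻¹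
        ≈⟨ *-congˡ (⁻¹-* (poch-nonzero-≤ n≤N hβ) hτ) ⟩
      (b * Pα * Tr * Qn * t) * (Pβ ⁻¹ * T ⁻¹)
        ≈⟨ solve 7 (λ b Pα Tr Qn t Pβ⁻ T⁻ → b :* Pα :* Tr :* Qn :* t :* (Pβ⁻ :* T⁻)
                   := (b :* Qn) :* T⁻ :* (Pα :* t :* Pβ⁻ :* Tr)) refl b Pα Tr Qn t (Pβ ⁻¹) (T ⁻¹) ⟩
      (b * Qn) * T ⁻¹ * (Pα * t * Pβ ⁻¹ * Tr)
        ≈⟨ *-congʳ (*-congʳ (qbinom-poch q N n (poch-nonzero-≤ n≤N hq) (poch-nonzero-≤ (ℕₚ.m∸n≤m N n) hq))) ⟩
      Q * Qr ⁻¹ * T ⁻¹ * (Pα * t * Pβ ⁻¹ * Tr)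
        ≈⟨ solve 7 (λ Q Qr⁻ T⁻ Pα t Pβ⁻ Tr → Q :* Qr⁻ :* T⁻ :* (Pα :* t :* Pβ⁻ :* Tr)
                   := Q :* T⁻ :* (Pα :* t :* Pβ⁻ :* (Tr :* Qr⁻))) refl Q (Qr ⁻¹) (T ⁻¹) Pα t (Pβ ⁻¹) Tr ⟩
      Q * T ⁻¹ * (c n * d (N ∸ n)) ∎
      where
      b  = qbinom q N n
      Pα = poch (α * q) q n
      Tr = poch τ q (N ∸ n)
      Qn = poch q q n
      Qr = poch q q (N ∸ n)
      t  = pow τ n
      Pβ = poch (β * q) q n

module RightSide {k ℓ} (𝔽 : Field k ℓ) (q α β τ : Field.Carrier 𝔽) where
  open Field 𝔽
  open FieldFacts 𝔽
  open LeftSide 𝔽 q α β τ using (d; u; u₀)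

  A : Carrier
  A = α * τ * q * q

  numerator ρ g : ℕ → Carrier
  numerator n = poch (α * q) q n * poch ((α * τ * q) / β) q n * pow (τ * β) n * pow q (n *ℕ n)
  ρ n = numerator n * (poch (β * q) q n) ⁻¹ * (poch τ q (suc n)) ⁻¹
  g n = 1# − α * τ * pow q (suc (n +ℕ n))

  E : ℕ → ℕ → Carrier
  E j K = (poch q q j) ⁻¹ * (poch A q K) ⁻¹

  w W : ℕ → Carrier
  w M = sumTo (λ n → ρ n * g n * E (M ∸ n) (M +ℕ n)) M
  W M = poch τ q (suc M) * poch A q M * w M

  φ : ℕ → Carrier
  φ n = (1# − β * pow q n) * (1# − τ * pow q n)

  -- numerator (n+1) / numerator n, cleared of the denominator β
  shift : ℕ → Carrier
  shift n = (1# − α * q * pow q n) * (τ * β − α * τ * q * τ * pow q n) * (pow q n * pow q n * q)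

  pow-square : ∀ n → pow q (suc n *ℕ suc n) ≈ pow q (n *ℕ n) * (pow q n * pow q n * q)
  pow-square n = begin
    pow q (n +ℕ n *ℕ suc n) * q           ≡⟨ ≡.cong (λ e → pow q (n +ℕ e) * q) (ℕₚ.*-suc n n) ⟩
    pow q (n +ℕ (n +ℕ n *ℕ n)) * q        ≈⟨ *-congʳ (trans (pow-+ q n _) (*-congˡ (pow-+ q n (n *ℕ n)))) ⟩
    pow q n * (pow q n * pow q (n *ℕ n)) * q
      ≈⟨ solve 3 (λ X S q → X :* (X :* S) :* q := S :* (X :* X :* q)) refl (pow q n) (pow q (n *ℕ n)) q ⟩
    pow q (n *ℕ n) * (pow q n * pow q n * q) ∎

  numerator-step : ∀ n → Nonzero β → numerator (suc n) ≈ numerator n * shift n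
  numerator-step n β≉0 = begin
    Pα * fα * (Pγ * (1# − α * τ * q * β ⁻¹ * X)) * (Pτβ * (τ * β)) * pow q (suc n *ℕ suc n)
      ≈⟨ *-congˡ (pow-square n) ⟩
    Pα * fα * (Pγ * (1# − α * τ * q * β ⁻¹ * X)) * (Pτβ * (τ * β)) * (S * (X * X * q))
      ≈⟨ solve 10 (λ Pα Pγ Pτβ S α q X τ β β⁻ → let 1: = con (+ 1) in
             Pα :* (1: :- α :* q :* X) :* (Pγ :* (1: :- α :* τ :* q :* β⁻ :* X)) :* (Pτβ :* (τ :* β)) :* (S :* (X :* X :* q))
             := Pα :* Pγ :* Pτβ :* S :* ((1: :- α :* q :* X) :* (τ :* β :- α :* τ :* q :* τ :* X :* (β :* β⁻)) :* (X :* X :* q)))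
           refl Pα Pγ Pτβ S α q X τ β (β ⁻¹) ⟩
    numerator n * (fα * (τ * β − α * τ * q * τ * X * (β * β ⁻¹)) * (X * X * q))
      ≈⟨ *-congˡ (*-congʳ (*-congˡ (+-congˡ (-‿cong (trans (*-congˡ (⁻¹-inverse β β≉0)) (*-identityʳ _)))))) ⟩
    numerator n * shift n ∎
    where
    X = pow q n
    fα = 1# − α * q * X
    Pα = poch (α * q) q n
    Pγ = poch ((α * τ * q) / β) q n
    Pτβ = pow (τ * β) n
    S = pow q (n *ℕ n)

  ρ-step : ∀ n → Nonzero β → Nonzero (poch (β * q) q (suc n)) → Nonzero (poch τ q (suc (suc n))) →
           φ (suc n) * ρ (suc n) ≈ shift n * ρ n
  ρ-step n β≉0 hβ hτ = begin
    φ (suc n) * (numerator (suc n) * Pβ' ⁻¹ * Pτ' ⁻¹)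
      ≈⟨ *-congˡ (*-congʳ (*-congʳ (numerator-step n β≉0))) ⟩
    φ (suc n) * (numerator n * shift n * Pβ' ⁻¹ * Pτ' ⁻¹)
      ≈⟨ solve 8 (λ β τ q X N s B⁻ T⁻ → let 1: = con (+ 1) in
             (1: :- β :* (X :* q)) :* (1: :- τ :* (X :* q)) :* (N :* s :* B⁻ :* T⁻)
             := s :* (N :* ((1: :- β :* q :* X) :* B⁻) :* ((1: :- τ :* (X :* q)) :* T⁻)))
           refl β τ q (pow q n) (numerator n) (shift n) (Pβ' ⁻¹) (Pτ' ⁻¹) ⟩
    shift n * (numerator n * ((1# − β * q * pow q n) * Pβ' ⁻¹) * ((1# − τ * pow q (suc n)) * Pτ' ⁻¹))
      ≈⟨ *-congˡ (*-cong (*-congˡ (poch⁻¹-step (β * q) q n hβ)) (poch⁻¹-step τ q (suc n) hτ)) ⟨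
    shift n * ρ n ∎
    where
    Pβ' = poch (β * q) q (suc n)
    Pτ' = poch τ q (suc (suc n))

  E-step-j : ∀ j K → Nonzero (poch q q (suc j)) → E j K ≈ (1# − q * pow q j) * E (suc j) K
  E-step-j j K h = trans (*-congʳ (poch⁻¹-step q q j h)) (*-assoc _ _ _)

  E-step-K : ∀ j K → Nonzero (poch A q (suc K)) → E j K ≈ (1# − A * pow q K) * E j (suc K)
  E-step-K j K h = trans (*-congˡ (poch⁻¹-step A q K h))
    (solve 3 (λ a f b → a :* (f :* b) := f :* (a :* b)) refl _ _ _)

  -- the telescoping certificate of the recurrence for w
  G : ℕ → ℕ → ℕ → Carrier
  G n j K = - (pow q j * φ n * ρ n * E j K)

  term-step : ∀ n j → Nonzero β → Nonzero (poch (β * q) q (suc n)) → Nonzero (poch τ q (suc (suc n))) →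
    Nonzero (poch q q (suc j)) → Nonzero (poch A q (suc (n +ℕ j +ℕ n))) →
    φ (suc (n +ℕ j)) * (ρ n * g n * E (suc j) (suc (n +ℕ j +ℕ n))) − ρ n * g n * E j (n +ℕ j +ℕ n)
      ≈ G (suc n) j (suc (n +ℕ j +ℕ n)) − G n (suc j) (n +ℕ j +ℕ n)
  term-step n j β≉0 hβ hτ hq hA = begin
    φ (suc (n +ℕ j)) * (ρ n * g n * e) − ρ n * g n * E j K
      ≈⟨ +-cong (*-cong φ≈ (*-congʳ (*-congˡ g≈))) (-‿cong (*-cong (*-congˡ g≈) E₀₀≈)) ⟩
    (1# − β * (X * Z * q)) * (1# − τ * (X * Z * q)) * (ρ n * (1# − α * τ * (X * X * q)) * e)
      − ρ n * (1# − α * τ * (X * X * q)) * ((1# − q * Z) * ((1# − A * (X * Z * X)) * e))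
      ≈⟨ solve 8 (λ q α β τ X Z r e → let 1: = con (+ 1) ; A = α :* τ :* q :* q in
             (1: :- β :* (X :* Z :* q)) :* (1: :- τ :* (X :* Z :* q)) :* (r :* (1: :- α :* τ :* (X :* X :* q)) :* e)
               :- r :* (1: :- α :* τ :* (X :* X :* q)) :* ((1: :- q :* Z) :* ((1: :- A :* (X :* Z :* X)) :* e))
             := :- (Z :* ((1: :- α :* q :* X) :* (τ :* β :- α :* τ :* q :* τ :* X) :* (X :* X :* q) :* r) :* ((1: :- q :* Z) :* e))
                :- :- (Z :* q :* ((1: :- β :* X) :* (1: :- τ :* X)) :* r :* ((1: :- A :* (X :* Z :* X)) :* e)))
           refl q α β τ X Z (ρ n) e ⟩
    - (Z * (shift n * ρ n) * ((1# − q * Z) * e)) − - (Z * q * φ n * ρ n * ((1# − A * (X * Z * X)) * e))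
      ≈⟨ +-cong (-‿cong (*-cong (trans (*-assoc _ _ _) (*-congˡ (ρ-step n β≉0 hβ hτ))) E₀₁≈))
                (-‿cong (-‿cong (*-congˡ E₁₀≈))) ⟨
    G (suc n) j (suc K) − G n (suc j) K ∎
    where
    X = pow q n
    Z = pow q j
    K = n +ℕ j +ℕ n
    e = E (suc j) (suc K)
    XZ≈ : pow q (n +ℕ j) ≈ X * Z
    XZ≈ = pow-+ q n j
    φ≈ : φ (suc (n +ℕ j)) ≈ (1# − β * (X * Z * q)) * (1# − τ * (X * Z * q))
    φ≈ = *-cong (+-congˡ (-‿cong (*-congˡ (*-congʳ XZ≈)))) (+-congˡ (-‿cong (*-congˡ (*-congʳ XZ≈))))
    g≈ : g n ≈ 1# − α * τ * (X * X * q)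
    g≈ = +-congˡ (-‿cong (*-congˡ (*-congʳ (pow-+ q n n))))
    K≈ : A * pow q K ≈ A * (X * Z * X)
    K≈ = *-congˡ (trans (pow-+ q (n +ℕ j) n) (*-congʳ XZ≈))
    E₀₁≈ : E j (suc K) ≈ (1# − q * Z) * e
    E₀₁≈ = E-step-j j (suc K) hq
    E₁₀≈ : E (suc j) K ≈ (1# − A * (X * Z * X)) * e
    E₁₀≈ = trans (E-step-K (suc j) K hA) (*-congʳ (+-congˡ (-‿cong K≈)))
    E₀₀≈ : E j K ≈ (1# − q * Z) * ((1# − A * (X * Z * X)) * e)
    E₀₀≈ = trans (E-step-j j K hq) (*-congˡ E₁₀≈)

  τ-ρ₀ : Nonzero (poch τ q 1) → (1# − τ * 1#) * ρ 0 ≈ 1#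
  τ-ρ₀ h = begin
    f * (1# * 1# * 1# * 1# * 1# ⁻¹ * T ⁻¹)   ≈⟨ *-congˡ (*-congʳ (*-congˡ 1⁻¹)) ⟩
    f * (1# * 1# * 1# * 1# * 1# * T ⁻¹)
      ≈⟨ solve 2 (λ f T⁻ → let 1: = con (+ 1) in f :* (1: :* 1: :* 1: :* 1: :* 1: :* T⁻) := (1: :* f) :* T⁻) refl f (T ⁻¹) ⟩
    T * T ⁻¹                                 ≈⟨ ⁻¹-inverse T h ⟩
    1#                                       ∎
    where
    f = 1# − τ * 1#
    T = poch τ q 1

  w-step : ∀ m → Nonzero β → Nonzero (poch (β * q) q (suc m)) → Nonzero (poch τ q (suc (suc m))) →
    Nonzero (poch q q (suc m)) → Nonzero (poch A q (suc m +ℕ suc m)) →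
    φ (suc m) * w (suc m) ≈ w m + pow q (suc m) * (1# − β) * E (suc m) m
  w-step m β≉0 hβ hτ hq hA = begin
    φ (suc m) * w (suc m)    ≈⟨ sumTo-scale _ _ (suc m) ⟩
    sumTo A' (suc m)         ≈⟨ telescope m A' B' H step last ⟩
    w m − H 0                ≈⟨ +-congˡ (-‿cong first) ⟩
    w m − - (pow q (suc m) * (1# − β) * E (suc m) m)  ≈⟨ +-congˡ (-‿involutive _) ⟩
    w m + pow q (suc m) * (1# − β) * E (suc m) m      ∎
    where
    A' B' H : ℕ → Carrier
    A' n = φ (suc m) * (ρ n * g n * E (suc m ∸ n) (suc m +ℕ n))
    B' n = ρ n * g n * E (m ∸ n) (m +ℕ n)
    H n = G n (suc m ∸ n) (m +ℕ n)
    step : ∀ n j → n +ℕ j ≡ m → A' n − B' n ≈ H (suc n) − H n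
    step n j ≡.refl rewrite ∸-suc-+ n j | ℕₚ.m+n∸m≡n n j | ℕₚ.+-suc (n +ℕ j) n =
      term-step n j β≉0 (poch-nonzero-≤ (s≤s (ℕₚ.m≤m+n n j)) hβ) (poch-nonzero-≤ (s≤s (s≤s (ℕₚ.m≤m+n n j))) hτ)
                (poch-nonzero-≤ (s≤s (ℕₚ.m≤n+m j n)) hq) (poch-nonzero-≤ K<2m+2 hA)
      where
      K<2m+2 : suc (n +ℕ j +ℕ n) ≤ suc (n +ℕ j +ℕ suc (n +ℕ j))
      K<2m+2 = s≤s (ℕₚ.+-monoʳ-≤ (n +ℕ j) (ℕₚ.m≤n⇒m≤1+n (ℕₚ.m≤m+n n j)))
    last : A' (suc m) ≈ - H (suc m)
    last rewrite ℕₚ.n∸n≡0 m = begin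
      φ' * (ρ' * (1# − α * τ * (P * q * q)) * e)
        ≈⟨ solve 7 (λ φ' ρ' α τ q P e → let 1: = con (+ 1) in
               φ' :* (ρ' :* (1: :- α :* τ :* (P :* q :* q)) :* e)
               := :- (:- (1: :* φ' :* ρ' :* ((1: :- α :* τ :* q :* q :* P) :* e)))) refl φ' ρ' α τ q P e ⟩
      - (- (1# * φ' * ρ' * ((1# − A * P) * e)))
        ≈⟨ -‿cong (-‿cong (*-congˡ (E-step-K 0 (m +ℕ suc m) hA))) ⟨
      - G (suc m) 0 (m +ℕ suc m) ∎
      where
      φ' = φ (suc m)
      ρ' = ρ (suc m)
      P  = pow q (m +ℕ suc m)
      e  = E 0 (suc (m +ℕ suc m))
    first : H 0 ≈ - (pow q (suc m) * (1# − β) * E (suc m) m)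
    first rewrite ℕₚ.+-identityʳ m = -‿cong (begin
      Q * ((1# − β * 1#) * (1# − τ * 1#)) * ρ 0 * E (suc m) m
        ≈⟨ solve 5 (λ Q fβ fτ r e → Q :* (fβ :* fτ) :* r :* e := Q :* fβ :* e :* (fτ :* r)) refl Q (1# − β * 1#) (1# − τ * 1#) (ρ 0) (E (suc m) m) ⟩
      Q * (1# − β * 1#) * E (suc m) m * ((1# − τ * 1#) * ρ 0)
        ≈⟨ *-congˡ (τ-ρ₀ (poch-nonzero-≤ {τ} {q} {1} {suc (suc m)} (s≤s z≤n) hτ)) ⟩
      Q * (1# − β * 1#) * E (suc m) m * 1#
        ≈⟨ solve 3 (λ Q β e → let 1: = con (+ 1) in Q :* (1: :- β :* 1:) :* e :* 1: := Q :* (1: :- β) :* e) refl Q β (E (suc m) m) ⟩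
      Q * (1# − β) * E (suc m) m ∎)
      where
      Q = pow q (suc m)

  -- the recurrence for the rescaled W; it has the same shape as the one
  -- satisfied by (1 - ατ q^{M+1}) u M
  W-step : ∀ m → Nonzero β → Nonzero (poch (β * q) q (suc m)) → Nonzero (poch τ q (suc (suc m))) →
    Nonzero (poch q q (suc m)) → Nonzero (poch A q (suc m +ℕ suc m)) →
    (1# − β * pow q (suc m)) * W (suc m)
      ≈ (1# − α * τ * pow q (suc (suc m))) * W m
        + (1# − α * τ * pow q (suc (suc m))) * ((1# − β) * pow q (suc m) * d (suc m))
  W-step m β≉0 hβ hτ hq hA = begin
    (1# − β * (P * q)) * (T * (1# − τ * (P * q)) * (Aₘ * (1# − A * P)) * w (suc m))
      ≈⟨ solve 8 (λ α β τ q P T Aₘ w₁ → let 1: = con (+ 1) in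
             (1: :- β :* (P :* q)) :* (T :* (1: :- τ :* (P :* q)) :* (Aₘ :* (1: :- α :* τ :* q :* q :* P)) :* w₁)
             := T :* Aₘ :* (1: :- α :* τ :* (P :* q :* q)) :* ((1: :- β :* (P :* q)) :* (1: :- τ :* (P :* q)) :* w₁))
           refl α β τ q P T Aₘ (w (suc m)) ⟩
    T * Aₘ * f' * (φ (suc m) * w (suc m))
      ≈⟨ *-congˡ (w-step m β≉0 hβ hτ hq hA) ⟩
    T * Aₘ * f' * (w m + P * q * (1# − β) * (Q ⁻¹ * Aₘ ⁻¹))
      ≈⟨ solve 9 (λ T Aₘ f' w₀ P q β Q⁻ A⁻ → let 1: = con (+ 1) in
             T :* Aₘ :* f' :* (w₀ :+ P :* q :* (1: :- β) :* (Q⁻ :* A⁻))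
             := f' :* (T :* Aₘ :* w₀) :+ f' :* ((1: :- β) :* (P :* q) :* (T :* Q⁻)) :* Aₘ :* A⁻)
           refl T Aₘ f' (w m) P q β (Q ⁻¹) (Aₘ ⁻¹) ⟩
    f' * W m + f' * ((1# − β) * pow q (suc m) * d (suc m)) * Aₘ * Aₘ ⁻¹
      ≈⟨ +-congˡ (*-*⁻¹ _ (poch-nonzero-≤ (ℕₚ.m≤n⇒m≤1+n (ℕₚ.m≤m+n m (suc m))) hA)) ⟩
    f' * W m + f' * ((1# − β) * pow q (suc m) * d (suc m)) ∎
    where
    f' = 1# − α * τ * pow q (suc (suc m))
    P  = pow q m
    T  = poch τ q (suc m)
    Aₘ = poch A q m
    Q  = poch q q (suc m)

  W-start : Nonzero (poch τ q 1) → W 0 ≈ (1# − α * τ * pow q 1) * u 0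
  W-start h = begin
    T * 1# * (ρ 0 * g 0 * (1# ⁻¹ * 1# ⁻¹))
      ≈⟨ solve 5 (λ f r g′ e₁ e₂ → let 1: = con (+ 1) in
             (1: :* f) :* 1: :* (r :* g′ :* (e₁ :* e₂)) := (f :* r) :* g′ :* (e₁ :* e₂))
           refl (1# − τ * 1#) (ρ 0) (g 0) (1# ⁻¹) (1# ⁻¹) ⟩
    (1# − τ * 1#) * ρ 0 * g 0 * (1# ⁻¹ * 1# ⁻¹)
      ≈⟨ *-cong (*-congʳ (τ-ρ₀ h)) (*-cong 1⁻¹ 1⁻¹) ⟩
    1# * g 0 * (1# * 1#)
      ≈⟨ solve 1 (λ g′ → let 1: = con (+ 1) in 1: :* g′ :* (1: :* 1:) := g′ :* 1:) refl (g 0) ⟩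
    g 0 * 1#
      ≈⟨ *-congˡ u₀ ⟨
    g 0 * u 0 ∎
    where
    T = poch τ q 1

  RHS-as-w : ∀ N → Nonzero (poch q q N) → Nonzero (poch (β * q) q N) → Nonzero (poch τ q (suc N)) →
    Nonzero (poch A q (N +ℕ N)) →
    RHS9p2 q α β τ N ≈ (1# − τ * pow q N) * (poch q q N * pochPred A q N * w N)
  RHS-as-w N hq hβ hτ hA = *-congˡ (begin
    sumTo _ N                                        ≈⟨ sumTo-cong N term ⟩
    sumTo (λ n → Q * R * (ρ n * g n * E (N ∸ n) (N +ℕ n))) N   ≈⟨ sumTo-scale _ _ N ⟨
    Q * R * w N                                      ∎)
    where
    Q = poch q q N
    R = pochPred A q N
    term : ∀ n → n ≤ N →
      (qbinom q N n * poch (α * q) q n * poch q q n * poch ((α * τ * q) / β) q n * R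
         * pow (τ * β) n * pow q (n *ℕ n) * g n)
        / (poch (β * q) q n * poch τ q (suc n) * poch A q (N +ℕ n))
      ≈ Q * R * (ρ n * g n * E (N ∸ n) (N +ℕ n))
    term n n≤N = begin
      (b * Pα * Qn * Pγ * R * Pτβ * S * g n) * (Pβ * T * Aₙ) ⁻¹
        ≈⟨ *-congˡ (trans (⁻¹-* (*-nonzero hPβ hT) hAₙ) (*-congʳ (⁻¹-* hPβ hT))) ⟩
      (b * Pα * Qn * Pγ * R * Pτβ * S * g n) * (Pβ ⁻¹ * T ⁻¹ * Aₙ ⁻¹)
        ≈⟨ solve 11 (λ b Pα Qn Pγ R Pτβ S g′ Pβ⁻ T⁻ A⁻ →
               b :* Pα :* Qn :* Pγ :* R :* Pτβ :* S :* g′ :* (Pβ⁻ :* T⁻ :* A⁻)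
               := b :* Qn :* R :* (Pα :* Pγ :* Pτβ :* S :* Pβ⁻ :* T⁻ :* g′ :* A⁻))
             refl b Pα Qn Pγ R Pτβ S (g n) (Pβ ⁻¹) (T ⁻¹) (Aₙ ⁻¹) ⟩
      b * Qn * R * (numerator n * Pβ ⁻¹ * T ⁻¹ * g n * Aₙ ⁻¹)
        ≈⟨ *-congʳ (*-congʳ (qbinom-poch q N n (poch-nonzero-≤ n≤N hq) (poch-nonzero-≤ (ℕₚ.m∸n≤m N n) hq))) ⟩
      Q * Qr ⁻¹ * R * (numerator n * Pβ ⁻¹ * T ⁻¹ * g n * Aₙ ⁻¹)
        ≈⟨ solve 6 (λ Q Qr⁻ R r g′ A⁻ → Q :* Qr⁻ :* R :* (r :* g′ :* A⁻) := Q :* R :* (r :* g′ :* (Qr⁻ :* A⁻)))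
             refl Q (Qr ⁻¹) R (ρ n) (g n) (Aₙ ⁻¹) ⟩
      Q * R * (ρ n * g n * E (N ∸ n) (N +ℕ n)) ∎
      where
      b   = qbinom q N n
      Pα  = poch (α * q) q n
      Qn  = poch q q n
      Qr  = poch q q (N ∸ n)
      Pγ  = poch ((α * τ * q) / β) q n
      Pτβ = pow (τ * β) n
      S   = pow q (n *ℕ n)
      Pβ  = poch (β * q) q n
      T   = poch τ q (suc n)
      Aₙ  = poch A q (N +ℕ n)
      hPβ = poch-nonzero-≤ n≤N hβ
      hT  = poch-nonzero-≤ (s≤s n≤N) hτ
      hAₙ = poch-nonzero-≤ (ℕₚ.+-monoʳ-≤ N n≤N) hA

module Comparison {k ℓ} (𝔽 : Field k ℓ) (q α β τ : Field.Carrier 𝔽) where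
  open Field 𝔽
  open FieldFacts 𝔽
  open LeftSide 𝔽 q α β τ using (u; d; u-step)
  open RightSide 𝔽 q α β τ using (A; W; W-step; W-start)

  f : ℕ → Carrier
  f M = 1# − α * τ * pow q (suc M)

  pochPred-f : ∀ N → (N ≡ 0 → Nonzero q × Nonzero (1# − α * τ * q)) →
               pochPred A q N * f N ≈ poch A q N
  pochPred-f N h = trans
    (*-congˡ (+-congˡ (-‿cong (solve 4 (λ α τ P q → α :* τ :* (P :* q) := α :* τ :* q :* P) refl α τ (pow q N) q))))
    (pochPred-extend (α * τ * q) q N h)

  W≈f·u : ∀ N → Nonzero β → Nonzero (poch q q N) → Nonzero (poch (β * q) q N) →
          Nonzero (poch τ q (suc N)) → Nonzero (poch A q (N +ℕ N)) → W N ≈ f N * u N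
  W≈f·u N β≉0 hq hβ hτ hA =
    sym (recurrence-unique a (λ m → f (suc m)) r (λ M → f M * u M) W N a≉0 fu-step W-step′ fu≈W N ℕₚ.≤-refl)
    where
    a r : ℕ → Carrier
    a m = 1# − β * pow q (suc m)
    r m = f (suc m) * ((1# − β) * pow q (suc m) * d (suc m))
    a≉0 : ∀ m → suc m ≤ N → Nonzero (a m)
    a≉0 m m<N = nonzero-cong (+-congˡ (-‿cong (solve 3 (λ β q P → β :* q :* P := β :* (P :* q)) refl β q (pow q m))))
                             (poch-factor-nonzero m<N hβ)
    fu-step : ∀ m → suc m ≤ N → a m * (f (suc m) * u (suc m)) ≈ f (suc m) * (f m * u m) + r m
    fu-step m m<N = begin
      a m * (f (suc m) * u (suc m))   ≈⟨ solve 3 (λ a f u → a :* (f :* u) := f :* (a :* u)) refl (a m) (f (suc m)) (u (suc m)) ⟩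
      f (suc m) * (a m * u (suc m))   ≈⟨ *-congˡ (u-step m (poch-nonzero-≤ m<N hβ) (poch-nonzero-≤ m<N hq)) ⟩
      f (suc m) * (f m * u m + (1# − β) * pow q (suc m) * d (suc m))  ≈⟨ distribˡ _ _ _ ⟩
      f (suc m) * (f m * u m) + r m   ∎
    W-step′ : ∀ m → suc m ≤ N → a m * W (suc m) ≈ f (suc m) * W m + r m
    W-step′ m m<N = W-step m β≉0 (poch-nonzero-≤ m<N hβ) (poch-nonzero-≤ (s≤s m<N) hτ)
                      (poch-nonzero-≤ m<N hq) (poch-nonzero-≤ (ℕₚ.+-mono-≤ m<N m<N) hA)
    fu≈W : f 0 * u 0 ≈ W 0
    fu≈W = sym (W-start (poch-nonzero-≤ {τ} {q} {1} {suc N} (s≤s z≤n) hτ))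

lemma9p2 : ∀ {c ℓ} (𝔽 : Field c ℓ) → let open Field 𝔽 in
    (q α β τ : Carrier) (N : ℕ) →
    ¬ (β ≈ 0#) →
    ¬ (poch q q N ≈ 0#) →
    ¬ (poch (β * q) q N ≈ 0#) →
    ¬ (poch τ q (suc N) ≈ 0#) →
    ¬ (poch (α * τ * q * q) q (N +ℕ N) ≈ 0#) →
    (N ≡ zero → ¬ (q ≈ 0#) × ¬ ((1# − α * τ * q) ≈ 0#)) →
    FN q α β τ N ≈ RHS9p2 q α β τ N
lemma9p2 𝔽 q α β τ N β≉0 hq hβ hτ hA h₀ = cancelʳ f≉0 (begin
  FN q α β τ N * f N                         ≈⟨ *-congʳ (F-as-convolution N hq hβ hτ′) ⟩
  Q * T ⁻¹ * u N * f N                       ≈⟨ solve 4 (λ Q T⁻ u f → Q :* T⁻ :* u :* f := Q :* T⁻ :* (f :* u)) refl Q (T ⁻¹) (u N) (f N) ⟩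
  Q * T ⁻¹ * (f N * u N)                     ≈⟨ *-congˡ (W≈f·u N β≉0 hq hβ hτ hA) ⟨
  Q * T ⁻¹ * (T * τ′ * Aₙ * w N)
    ≈⟨ solve 6 (λ Q T⁻ T τ′ A w → Q :* T⁻ :* (T :* τ′ :* A :* w) := τ′ :* (Q :* A :* w) :* T :* T⁻) refl Q (T ⁻¹) T τ′ Aₙ (w N) ⟩
  τ′ * (Q * Aₙ * w N) * T * T ⁻¹             ≈⟨ *-*⁻¹ _ hτ′ ⟩
  τ′ * (Q * Aₙ * w N)                        ≈⟨ *-congˡ (*-congʳ (*-congˡ (pochPred-f N h₀))) ⟨
  τ′ * (Q * (pochPred A q N * f N) * w N)
    ≈⟨ solve 5 (λ τ′ Q P f w → τ′ :* (Q :* (P :* f) :* w) := τ′ :* (Q :* P :* w) :* f) refl τ′ Q (pochPred A q N) (f N) (w N) ⟩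
  τ′ * (Q * pochPred A q N * w N) * f N      ≈⟨ *-congʳ (RHS-as-w N hq hβ hτ hA) ⟨
  RHS9p2 q α β τ N * f N                     ∎)
  where
  open Field 𝔽
  open FieldFacts 𝔽
  open LeftSide 𝔽 q α β τ using (u; F-as-convolution)
  open RightSide 𝔽 q α β τ using (A; w; RHS-as-w)
  open Comparison 𝔽 q α β τ using (f; pochPred-f; W≈f·u)
  Q  = poch q q N
  T  = poch τ q N
  τ′ = 1# − τ * pow q N
  Aₙ = poch A q N
  hτ′ : Nonzero T
  hτ′ = poch-nonzero-≤ (ℕₚ.n≤1+n N) hτ
  -- f N ≠ 0 because f N completes the nonzero (ατq²)_N
  f≉0 : Nonzero (f N)
  f≉0 = nonzero-*ʳ (nonzero-cong (sym (pochPred-f N h₀)) (poch-nonzero-≤ (ℕₚ.m≤m+n N N) hA))
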